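{- Let $c\geq 3$ and let $G_1, G_2, \ldots, G_c$ be oriented graphs on a common set of $n$ vertices. If $\sum_{i = 1}^c e(G_i) > \frac{c}{3}n^2$, then there exists a rainbow transitive triangle.
   Context: A directed graph $G$ consists of a vertex set $V(G)$ and an edge set $E(G)$ of ordered pairs of distinct vertices (no loops, no multiple edges). An oriented graph is a directed graph with no pair of vertices $u,v$ such that both $(u,v)$ and $(v,u)$ are edges. $e(G)=|E(G)|$. The edges of $G_i$ are thought of as having color $i$. A rainbow transitive triangle is a triple of distinct vertices $u,v,w$ together with pairwise distinct colors $a,b,d$ such that $(u,v)\in E(G_a)$, $(v,w)\in E(G_b)$, $(u,w)\in E(G_d)$. -}

module Defs where

open import Data.Nat using (ℕ; _+_)
open import Data.Bool using (Bool; true; false; T)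
open import Data.Fin using (Fin)
open import Data.List using (List; map)
open import Data.Nat.ListAction using (sum)
open import Data.List using (allFin) public
open import Data.Product using (_×_; ∃-syntax)
open import Relation.Binary.PropositionalEquality using (_≡_; _≢_)
open import Relation.Nullary using (¬_)

DiGraph : ℕ → Set
DiGraph n = Fin n → Fin n → Bool

ind : Bool → ℕ
ind true  = 1
ind false = 0

sumFin : {n : ℕ} → (Fin n → ℕ) → ℕ
sumFin {n} f = sum (map f (allFin n))

e : {n : ℕ} → DiGraph n → ℕ
e G = sumFin (λ u → sumFin (λ v → ind (G u v)))

Loopless : {n : ℕ} → DiGraph n → Set
Loopless G = ∀ u → G u u ≡ false

Oriented : {n : ℕ} → DiGraph n → Set
Oriented G = Loopless G × (∀ u v → ¬ (T (G u v) × T (G v u)))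

RainbowTransitiveTriangle : {c n : ℕ} → (Fin c → DiGraph n) → Set
RainbowTransitiveTriangle {c} {n} G =
  ∃[ u ] ∃[ v ] ∃[ w ] ∃[ a ] ∃[ b ] ∃[ d ]
    ((u ≢ v) × (v ≢ w) × (u ≢ w)) ×
    ((a ≢ b) × (b ≢ d) × (a ≢ d)) ×
    (T (G a u v) × T (G b v w) × T (G d u w))

-- Dropping a colour of least weight keeps the density condition, so it suffices to show that three
-- oriented graphs on n vertices without a rainbow transitive triangle have at most n² edges in total.
-- Record, for every pair of vertices and every colour, whether there is an edge and in which direction.
-- Rainbow-freeness says exactly that three edges of distinct colours on the sides of a triangle form
-- a directed cycle. A finite check then shows that a triangle carrying at least 8 of its 9 possible
-- coloured edges is cyclically oriented, and that every other vertex sends at most 6 edges into it.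
-- So one can always split off a single vertex (if no pair carries all three colours), a pair carrying
-- three colours with at most 4 edges to every other vertex, or a triangle with at least 8 edges;
-- removing s vertices with m remaining deletes at most s² + 2sm edges, and induction gives n².

module Submission where

open import Defs
open import Data.Nat using (ℕ; zero; suc; _+_; _*_; _≤_; _<_; _≥_; _>_; z≤n; s≤s; _≤?_; NonZero)
open import Data.Nat.Properties
open import Data.Nat.Induction using (<-wellFounded)
open import Data.Nat.ListAction using (sum)
open import Data.Nat.ListAction.Properties using (sum-++; sum-↭)
open import Data.Nat.Tactic.RingSolver using (solve-∀)
open import Algebra.Properties.CommutativeMonoid.Sum +-0-commutativeMonoid
  using (∑-comm; sum-remove; sum-cong-≗) renaming (sum to ∑)
open import Algebra.Properties.CommutativeSemigroup +-commutativeSemigroup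
  using (xy∙z≈yz∙x; xy∙z≈zx∙y; xy∙z≈zy∙x; xy∙z≈xz∙y) renaming (interchange to +-interchange)
open import Data.Bool using (Bool; true; false; T; _∧_; _∨_)
open import Data.Bool.Properties using (T-∧; T-∨)
open import Data.Empty using (⊥-elim)
open import Data.Fin using (Fin; zero; suc; punchIn)
open import Data.Fin.Patterns using (0F; 1F; 2F)
open import Data.Fin.Properties using (all?; any?; punchIn-injective) renaming (_≟_ to _≟ᶠ_)
open import Data.List using (List; []; _∷_; _++_; map; length; tabulate)
open import Data.List.Properties using (map-cong; map-++; length-++; length-tabulate; map-tabulate)
open import Data.List.Relation.Unary.All using (All; []; _∷_; universal)
import Data.List.Relation.Unary.All as All
open import Data.List.Relation.Unary.All.Properties using (¬Any⇒All¬)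
open import Data.List.Relation.Unary.Any using (Any; here; there)
import Data.List.Relation.Unary.Any as Any
open import Data.List.Relation.Binary.Permutation.Propositional using (_↭_; prep; swap; ↭-refl; ↭-trans)
open import Data.List.Relation.Binary.Permutation.Propositional.Properties
  using (map⁺; Any-resp-↭; ↭-length; ++-comm; ∷↭∷ʳ)
open import Data.Product using (_×_; _,_; proj₁; proj₂; ∃-syntax)
open import Data.Sum using (_⊎_; inj₁; inj₂; [_,_]′)
open import Function using (_∘_; id; case_of_; Equivalence)
open import Function.Definitions using (Injective)
open import Induction.WellFounded using (Acc; acc)
open import Relation.Binary.PropositionalEquality
open import Relation.Nullary using (¬_; Dec; yes; no)
open import Relation.Nullary.Decidable using (¬?; _×-dec_; _⊎-dec_; _→-dec_; T?; from-yes)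

sumFin≡∑ : ∀ {m} (f : Fin m → ℕ) → sumFin f ≡ ∑ f
sumFin≡∑ f = trans (cong sum (map-tabulate id f)) (sum-tabulate f)
  where
  sum-tabulate : ∀ {m} (f : Fin m → ℕ) → sum (tabulate f) ≡ ∑ f
  sum-tabulate {zero}  f = refl
  sum-tabulate {suc m} f = cong (f zero +_) (sum-tabulate (f ∘ suc))

sumFin-comm : ∀ {m k} (f : Fin m → Fin k → ℕ) →
              sumFin (λ i → sumFin (f i)) ≡ sumFin (λ j → sumFin (λ i → f i j))
sumFin-comm f = begin
  sumFin (λ i → sumFin (f i))          ≡⟨ sumFin≡∑ (λ i → sumFin (f i)) ⟩
  ∑ (λ i → sumFin (f i))               ≡⟨ sum-cong-≗ (λ i → sumFin≡∑ (f i)) ⟩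
  ∑ (λ i → ∑ (f i))                    ≡⟨ ∑-comm f ⟩
  ∑ (λ j → ∑ (λ i → f i j))            ≡⟨ sum-cong-≗ (λ j → sumFin≡∑ (λ i → f i j)) ⟨
  ∑ (λ j → sumFin (λ i → f i j))       ≡⟨ sumFin≡∑ (λ j → sumFin (λ i → f i j)) ⟨
  sumFin (λ j → sumFin (λ i → f i j))  ∎
  where open ≡-Reasoning

sumFin-remove : ∀ {m} (f : Fin (suc m) → ℕ) i → sumFin f ≡ f i + sumFin (f ∘ punchIn i)
sumFin-remove f i = begin
  sumFin f                       ≡⟨ sumFin≡∑ f ⟩
  ∑ f                            ≡⟨ sum-remove {i = i} f ⟩
  f i + ∑ (f ∘ punchIn i)        ≡⟨ cong (f i +_) (sumFin≡∑ (f ∘ punchIn i)) ⟨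
  f i + sumFin (f ∘ punchIn i)   ∎
  where open ≡-Reasoning

*≤sumFin : ∀ {m} (f : Fin m → ℕ) {k} → (∀ i → k ≤ f i) → m * k ≤ sumFin f
*≤sumFin f k≤f = ≤-trans (*≤∑ f k≤f) (≤-reflexive (sym (sumFin≡∑ f)))
  where
  *≤∑ : ∀ {m} (f : Fin m → ℕ) {k} → (∀ i → k ≤ f i) → m * k ≤ ∑ f
  *≤∑ {zero}  f k≤f = z≤n
  *≤∑ {suc m} f k≤f = +-mono-≤ (k≤f zero) (*≤∑ (f ∘ suc) (k≤f ∘ suc))

minimum : ∀ {m} (f : Fin (suc m) → ℕ) → ∃[ i ] (∀ j → f i ≤ f j)
minimum {zero}  f = zero , λ { zero → ≤-refl }
minimum {suc m} f with minimum (f ∘ suc)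
... | i , min with f zero ≤? f (suc i)
...   | yes f₀≤ = zero  , λ { zero → ≤-refl ; (suc j) → ≤-trans f₀≤ (min j) }
...   | no  f₀≰ = suc i , λ { zero → <⇒≤ (≰⇒> f₀≰) ; (suc j) → min j }

sum-map-+ : ∀ {A : Set} (f g : A → ℕ) xs →
            sum (map (λ x → f x + g x) xs) ≡ sum (map f xs) + sum (map g xs)
sum-map-+ f g []       = refl
sum-map-+ f g (x ∷ xs) rewrite sum-map-+ f g xs = +-interchange (f x) (g x) _ _

sum-map-≤ : ∀ {A : Set} (f : A → ℕ) {k} {xs} → All (λ x → f x ≤ k) xs →
            sum (map f xs) ≤ length xs * k
sum-map-≤ f []         = z≤n
sum-map-≤ f (p ∷ ps) = +-mono-≤ p (sum-map-≤ f ps)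

m+n≤o+p⇒o≤m⇒n≤p : ∀ m {n o p} → m + n ≤ o + p → o ≤ m → n ≤ p
m+n≤o+p⇒o≤m⇒n≤p m {n} {o} {p} le o≤m = +-cancelˡ-≤ m n p (≤-trans le (+-monoˡ-≤ p o≤m))

pigeonhole : ∀ p q r → 7 ≤ p + q + r → 3 ≤ p ⊎ 3 ≤ q ⊎ 3 ≤ r
pigeonhole p q r seven≤ with 3 ≤? p | 3 ≤? q | 3 ≤? r
... | yes p≥3 | _       | _       = inj₁ p≥3
... | no _    | yes q≥3 | _       = inj₂ (inj₁ q≥3)
... | no _    | no _    | yes r≥3 = inj₂ (inj₂ r≥3)
... | no p≱3  | no q≱3  | no r≱3  =
  ⊥-elim (<⇒≱ (s≤s (+-mono-≤ (+-mono-≤ (≤2 p≱3) (≤2 q≱3)) (≤2 r≱3))) seven≤)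
  where
  ≤2 : ∀ {k} → ¬ 3 ≤ k → k ≤ 2
  ≤2 = ≤-pred ∘ ≰⇒>

-- Discarding colours

rainbow-recolour : ∀ {c c′ n} (G : Fin c → DiGraph n) {σ : Fin c′ → Fin c} →
                   Injective _≡_ _≡_ σ → RainbowTransitiveTriangle (G ∘ σ) → RainbowTransitiveTriangle G
rainbow-recolour G {σ} σ-inj (u , v , w , a , b , d , distinct , (a≢b , b≢d , a≢d) , edges) =
  u , v , w , σ a , σ b , σ d , distinct , (a≢b ∘ σ-inj , b≢d ∘ σ-inj , a≢d ∘ σ-inj) , edges

-- x is the weight of a lightest one of m + 1 colours, r the total weight of the others.
lightest-removable : ∀ m {N x r} .{{_ : NonZero m}} →
                     suc m * x ≤ x + r → suc m * N < 3 * (x + r) → m * N < 3 * r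
lightest-removable m {N} {x} {r} lightest dense = *-cancelˡ-< (suc m) _ _ (begin-strict
  suc m * (m * N)         ≡⟨ *-left-comm (suc m) m N ⟩
  m * (suc m * N)         <⟨ *-monoʳ-< m dense ⟩
  m * (3 * (x + r))       ≡⟨ distribute m x r ⟩
  3 * (m * x) + m * (3 * r) ≤⟨ +-monoˡ-≤ (m * (3 * r)) (*-monoʳ-≤ 3 (+-cancelˡ-≤ x _ _ lightest)) ⟩
  3 * r + m * (3 * r)     ∎)
  where
  open ≤-Reasoning
  *-left-comm : ∀ a b c → a * (b * c) ≡ b * (a * c)
  *-left-comm = solve-∀
  distribute : ∀ m x r → m * (3 * (x + r)) ≡ 3 * (m * x) + m * (3 * r)
  distribute = solve-∀

-- Links

-- The state of one colour on an ordered pair (x , y): no edge, x → y, or y → x.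
data Dir : Set where
  none fwd bwd : Dir

opposite : Dir → Dir
opposite none = none
opposite fwd  = bwd
opposite bwd  = fwd

present : Dir → ℕ
present none = 0
present _    = 1

isFwd isBwd isPresent : Dir → Bool
isFwd fwd = true
isFwd _   = false
isBwd bwd = true
isBwd _   = false
isPresent none = false
isPresent _    = true

Link : Set
Link = Dir × Dir × Dir

_at_ : Link → Fin 3 → Dir
(d , _ , _) at 0F = d
(_ , d , _) at 1F = d
(_ , _ , d) at 2F = d

reverse : Link → Link
reverse (d₀ , d₁ , d₂) = opposite d₀ , opposite d₁ , opposite d₂

weight : Link → ℕ
weight (d₀ , d₁ , d₂) = present d₀ + present d₁ + present d₂

weight≤3 : ∀ l → weight l ≤ 3
weight≤3 (d₀ , d₁ , d₂) = +-mono-≤ (+-mono-≤ (present≤1 d₀) (present≤1 d₁)) (present≤1 d₂)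
  where
  present≤1 : ∀ d → present d ≤ 1
  present≤1 none = z≤n
  present≤1 fwd  = s≤s z≤n
  present≤1 bwd  = s≤s z≤n

weight-reverse : ∀ l → weight (reverse l) ≡ weight l
weight-reverse (d₀ , d₁ , d₂) =
  cong₂ _+_ (cong₂ _+_ (present-opposite d₀) (present-opposite d₁)) (present-opposite d₂)
  where
  present-opposite : ∀ d → present (opposite d) ≡ present d
  present-opposite none = refl
  present-opposite fwd  = refl
  present-opposite bwd  = refl

weight-self-reverse : ∀ l → l ≡ reverse l → weight l ≡ 0
weight-self-reverse (d₀ , d₁ , d₂) l≡rl =
  cong₂ _+_ (cong₂ _+_ (absent (cong proj₁ l≡rl)) (absent (cong (proj₁ ∘ proj₂) l≡rl)))
            (absent (cong (proj₂ ∘ proj₂) l≡rl))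
  where
  absent : ∀ {d} → d ≡ opposite d → present d ≡ 0
  absent {none} _ = refl
  absent {fwd}  ()
  absent {bwd}  ()

Forward Backward : Link → Set
Forward  l = ∀ i → ¬ T (isBwd (l at i))
Backward l = Forward (reverse l)

-- At a source of a triangle both sides leave the vertex and the opposite side carries an edge.
source : Dir → Dir → Dir → Bool
source out in′ opposite-side = isFwd out ∧ isBwd in′ ∧ isPresent opposite-side

-- d₁ , d₂ , d₃ are read along the sides ab , bc , ca of a triangle abc.
transitive : Dir → Dir → Dir → Bool
transitive d₁ d₂ d₃ = source d₁ d₃ d₂ ∨ source d₂ d₁ d₃ ∨ source d₃ d₂ d₁

Consistent : Link → Link → Link → Set
Consistent l₁ l₂ l₃ =
  ∀ i j k → i ≢ j → j ≢ k → i ≢ k → ¬ T (transitive (l₁ at i) (l₂ at j) (l₃ at k))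

all-Dir? : {P : Dir → Set} → (∀ d → Dec (P d)) → Dec (∀ d → P d)
all-Dir? P? with P? none | P? fwd | P? bwd
... | yes p | yes q | yes r = yes λ { none → p ; fwd → q ; bwd → r }
... | no ¬p | _     | _     = no λ all → ¬p (all none)
... | yes _ | no ¬q | _     = no λ all → ¬q (all fwd)
... | yes _ | yes _ | no ¬r = no λ all → ¬r (all bwd)

all-Link? : {P : Link → Set} → (∀ l → Dec (P l)) → Dec (∀ l → P l)
all-Link? P? with all-Dir? (λ d₀ → all-Dir? λ d₁ → all-Dir? λ d₂ → P? (d₀ , d₁ , d₂))
... | yes all = yes λ { (d₀ , d₁ , d₂) → all d₀ d₁ d₂ }
... | no ¬all = no λ all → ¬all λ d₀ d₁ d₂ → all (d₀ , d₁ , d₂)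

forward? : ∀ l → Dec (Forward l)
forward? l = all? λ i → ¬? (T? _)

backward? : ∀ l → Dec (Backward l)
backward? l = forward? (reverse l)

consistent? : ∀ l₁ l₂ l₃ → Dec (Consistent l₁ l₂ l₃)
consistent? l₁ l₂ l₃ = all? λ i → all? λ j → all? λ k →
  ¬? (i ≟ᶠ j) →-dec ¬? (j ≟ᶠ k) →-dec ¬? (i ≟ᶠ k) →-dec ¬? (T? _)

-- Checked by evaluating the decision procedures on all links; opaque, so that the enumeration
-- is not rerun whenever the facts are applied.

opaque
  forward-backward-empty : ∀ l → Forward l → Backward l → weight l ≡ 0
  forward-backward-empty = from-yes (all-Link? λ l → forward? l →-dec backward? l →-dec weight l ≟ 0)

  heavy-consistent-cyclic : ∀ l₁ l₂ l₃ → 8 ≤ weight l₁ + weight l₂ + weight l₃ → Consistent l₁ l₂ l₃ →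
                            (Forward l₁ × Forward l₂ × Forward l₃) ⊎
                            (Backward l₁ × Backward l₂ × Backward l₃)
  heavy-consistent-cyclic = from-yes (all-Link? λ l₁ → all-Link? λ l₂ → all-Link? λ l₃ →
    (8 ≤? weight l₁ + weight l₂ + weight l₃) →-dec consistent? l₁ l₂ l₃ →-dec
    ((forward? l₁ ×-dec forward? l₂ ×-dec forward? l₃) ⊎-dec
     (backward? l₁ ×-dec backward? l₂ ×-dec backward? l₃)))

  common-sink-links : ∀ l₁ l₂ l₃ → Forward l₁ → 2 ≤ weight l₁ → Backward l₂ → 3 ≤ weight l₂ →
                      Consistent l₁ l₂ l₃ → weight l₃ ≡ 0
  common-sink-links = from-yes (all-Link? λ l₁ → all-Link? λ l₂ → all-Link? λ l₃ →
    forward? l₁ →-dec (2 ≤? weight l₁) →-dec backward? l₂ →-dec (3 ≤? weight l₂) →-dec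
    consistent? l₁ l₂ l₃ →-dec weight l₃ ≟ 0)

  common-source-links : ∀ l₁ l₂ l₃ → Forward l₁ → 2 ≤ weight l₁ → Backward l₃ → 3 ≤ weight l₃ →
                        Consistent l₁ l₂ l₃ → weight l₂ ≡ 0
  common-source-links = from-yes (all-Link? λ l₁ → all-Link? λ l₂ → all-Link? λ l₃ →
    forward? l₁ →-dec (2 ≤? weight l₁) →-dec backward? l₃ →-dec (3 ≤? weight l₃) →-dec
    consistent? l₁ l₂ l₃ →-dec weight l₂ ≟ 0)

pairSum : {V : Set} → (V → V → ℕ) → List V → ℕ
pairSum f []       = 0
pairSum f (x ∷ xs) = sum (map (λ y → f y x) xs) + pairSum f xs

pairSum-↭ : ∀ {V : Set} {f : V → V → ℕ} → (∀ x y → f x y ≡ f y x) →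
            ∀ {xs ys} → xs ↭ ys → pairSum f xs ≡ pairSum f ys
pairSum-↭ f-sym _↭_.refl     = refl
pairSum-↭ f-sym (prep x p)   = cong₂ _+_ (sum-↭ (map⁺ _ p)) (pairSum-↭ f-sym p)
pairSum-↭ {f = f} f-sym (swap x y p) = trans
  (cong₂ _+_ (cong₂ _+_ (f-sym y x) (sum-↭ (map⁺ _ p)))
             (cong₂ _+_ (sum-↭ (map⁺ _ p)) (pairSum-↭ f-sym p)))
  (+-interchange (f x y) _ _ _)
pairSum-↭ f-sym (_↭_.trans p q) = trans (pairSum-↭ f-sym p) (pairSum-↭ f-sym q)

pairSum-++ : ∀ {V : Set} (f : V → V → ℕ) xs ys →
             pairSum f (xs ++ ys) ≡
             pairSum f xs + sum (map (λ x → sum (map (λ y → f y x) ys)) xs) + pairSum f ys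
pairSum-++ f []       ys = refl
pairSum-++ f (x ∷ xs) ys = begin
  sum (map g (xs ++ ys)) + pairSum f (xs ++ ys)
    ≡⟨ cong₂ _+_ (trans (cong sum (map-++ g xs ys)) (sum-++ (map g xs) (map g ys))) (pairSum-++ f xs ys) ⟩
  (sum (map g xs) + sum (map g ys)) + (pairSum f xs + cross + pairSum f ys)
    ≡⟨ regroup (sum (map g xs)) _ _ _ _ ⟩
  (sum (map g xs) + pairSum f xs) + (sum (map g ys) + cross) + pairSum f ys ∎
  where
  open ≡-Reasoning
  g = λ y → f y x
  cross = sum (map (λ z → sum (map (λ y → f y z) ys)) xs)
  regroup : ∀ a b p c q → a + b + (p + c + q) ≡ a + p + (b + c) + q
  regroup = solve-∀

pairSum-++-≤ : ∀ {V : Set} (f : V → V → ℕ) xs ys →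
               pairSum f xs ≤ length xs * length xs →
               All (λ x → sum (map (λ y → f y x) ys) ≤ 2 * length ys) xs →
               pairSum f ys ≤ length ys * length ys →
               pairSum f (xs ++ ys) ≤ length (xs ++ ys) * length (xs ++ ys)
pairSum-++-≤ f xs ys xs-bound cross-bound ys-bound = begin
  pairSum f (xs ++ ys)                   ≡⟨ pairSum-++ f xs ys ⟩
  pairSum f xs + _ + pairSum f ys        ≤⟨ +-mono-≤ (+-mono-≤ xs-bound (sum-map-≤ _ cross-bound)) ys-bound ⟩
  m * m + m * (2 * s) + s * s            ≡⟨ square-of-sum m s ⟩
  (m + s) * (m + s)                      ≡⟨ cong (λ k → k * k) (length-++ xs) ⟨
  length (xs ++ ys) * length (xs ++ ys)  ∎
  where
  open ≤-Reasoning
  m = length xs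
  s = length ys
  square-of-sum : ∀ m s → m * m + m * (2 * s) + s * s ≡ (m + s) * (m + s)
  square-of-sum = solve-∀

double-sum≡pairSum : ∀ {V : Set} (w : V → V → ℕ) {f : V → V → ℕ} → (∀ x → w x x ≡ 0) →
                     (∀ x y → f x y ≡ w x y + w y x) →
                     ∀ xs → sum (map (λ x → sum (map (w x) xs)) xs) ≡ pairSum f xs
double-sum≡pairSum w w-self f≡ [] = refl
double-sum≡pairSum w {f} w-self f≡ (x ∷ xs) = begin
  (w x x + out) + sum (map (λ u → w u x + sum (map (w u) xs)) xs)
    ≡⟨ cong₂ _+_ (cong (_+ out) (w-self x)) (sum-map-+ (λ u → w u x) (λ u → sum (map (w u) xs)) xs) ⟩
  out + (in′ + double xs)
    ≡⟨ +-assoc out in′ (double xs) ⟨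
  out + in′ + double xs
    ≡⟨ cong₂ _+_ (+-comm out in′) (double-sum≡pairSum w w-self f≡ xs) ⟩
  in′ + out + pairSum f xs
    ≡⟨ cong (_+ pairSum f xs)
         (trans (cong sum (map-cong (λ y → f≡ y x) xs)) (sum-map-+ (λ y → w y x) (w x) xs)) ⟨
  sum (map (λ y → f y x) xs) + pairSum f xs ∎
  where
  open ≡-Reasoning
  out = sum (map (w x) xs)
  in′ = sum (map (λ u → w u x) xs)
  double : List _ → ℕ
  double ys = sum (map (λ u → sum (map (w u) ys)) ys)

extract : ∀ {A : Set} {P : A → Set} {xs} → Any P xs → ∃[ x ] ∃[ ys ] P x × xs ↭ x ∷ ys
extract (here px) = _ , _ , px , ↭-refl
extract (there {x = y} p) with extract p
... | x , ys , px , xs↭ = x , y ∷ ys , px , ↭-trans (prep y xs↭) (swap y x ↭-refl)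

-- Consistent link structures

module LinkStructure {V : Set} (link : V → V → Link)
  (link-reverse : ∀ x y → link y x ≡ reverse (link x y))
  (link-consistent : ∀ a b c → Consistent (link a b) (link b c) (link c a)) where

  mult : V → V → ℕ
  mult x y = weight (link x y)

  mult-sym : ∀ x y → mult x y ≡ mult y x
  mult-sym x y = sym (trans (cong weight (link-reverse x y)) (weight-reverse (link x y)))

  mult≤3 : ∀ x y → mult x y ≤ 3
  mult≤3 x y = weight≤3 (link x y)

  mult-self : ∀ x → mult x x ≡ 0
  mult-self x = weight-self-reverse (link x x) (link-reverse x x)

  backward⇒forward : ∀ {x y} → Backward (link x y) → Forward (link y x)
  backward⇒forward {x} {y} = subst Forward (sym (link-reverse x y))

  forward⇒backward : ∀ {x y} → Forward (link y x) → Backward (link x y)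
  forward⇒backward {x} {y} = subst Forward (link-reverse x y)

  Heavy : V → V → V → Set
  Heavy a b c = 8 ≤ mult a b + mult b c + mult c a

  Cyclic : V → V → V → Set
  Cyclic a b c = Forward (link a b) × Forward (link b c) × Forward (link c a)

  heavy-rotate : ∀ {a b c} → Heavy a b c → Heavy b c a
  heavy-rotate {a} {b} {c} = subst (8 ≤_) (xy∙z≈yz∙x (mult a b) (mult b c) (mult c a))

  heavy-reflect : ∀ {a b c} → Heavy a b c → Heavy a c b
  heavy-reflect {a} {b} {c} = subst (8 ≤_) (trans (xy∙z≈zy∙x (mult a b) (mult b c) (mult c a))
    (cong₂ _+_ (cong₂ _+_ (mult-sym c a) (mult-sym b c)) (mult-sym a b)))

  heavy⇒2≤ : ∀ {a b c} → Heavy a b c → 2 ≤ mult c a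
  heavy⇒2≤ {a} {b} {c} heavy = m+n≤o+p⇒o≤m⇒n≤p 6 heavy (+-mono-≤ (mult≤3 a b) (mult≤3 b c))

  cyclic-rotate : ∀ {a b c} → Cyclic a b c → Cyclic b c a
  cyclic-rotate (ab , bc , ca) = bc , ca , ab

  heavy⇒cyclic : ∀ {a b c} → Heavy a b c → Cyclic a b c ⊎ Cyclic a c b
  heavy⇒cyclic {a} {b} {c} heavy
    with heavy-consistent-cyclic (link a b) (link b c) (link c a) heavy (link-consistent a b c)
  ... | inj₁ cyclic          = inj₁ cyclic
  ... | inj₂ (ab , bc , ca) = inj₂ (backward⇒forward ca , backward⇒forward bc , backward⇒forward ab)

  two-way-empty : ∀ {x y} → Forward (link x y) → Forward (link y x) → mult x y ≡ 0
  two-way-empty {x} {y} xy yx = forward-backward-empty (link x y) xy (forward⇒backward yx)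

  no-common-sink : ∀ {a b c} → Forward (link a b) → 2 ≤ mult a b → Forward (link c b) → 3 ≤ mult c b →
                   mult c a ≡ 0
  no-common-sink {a} {b} {c} ab 2≤ab cb 3≤cb =
    common-sink-links (link a b) (link b c) (link c a) ab 2≤ab (forward⇒backward cb)
      (subst (3 ≤_) (mult-sym c b) 3≤cb) (link-consistent a b c)

  no-common-source : ∀ {a b c} → Forward (link a b) → 2 ≤ mult a b → Forward (link a c) → 3 ≤ mult a c →
                     mult b c ≡ 0
  no-common-source {a} {b} {c} ab 2≤ab ac 3≤ac =
    common-source-links (link a b) (link b c) (link c a) ab 2≤ab (forward⇒backward ac)
      (subst (3 ≤_) (mult-sym a c) 3≤ac) (link-consistent a b c)

  -- One of the triangles abx, cax is heavy, hence cyclic; either orientation makes a a common sink of c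
  -- and x, or a common source of b and x, or puts edges on a side in both directions.
  cyclic-heavy-full⇒degree≱7 : ∀ {a b c x} → Cyclic a b c → Heavy a b c → 3 ≤ mult a x →
                        ¬ 7 ≤ mult a x + mult b x + mult c x
  cyclic-heavy-full⇒degree≱7 {a} {b} {c} {x} (ab , _ , ca) heavy 3≤ax dense =
    case 5 ≤? mult a b + mult b x of λ where
      (yes 5≤abx) → case heavy⇒cyclic {a} {b} {x} (+-mono-≤ 5≤abx 3≤xa) of λ where
        (inj₁ (_ , _ , xa)) → m<n⇒n≢0 1≤cx (trans (mult-sym c x) (no-common-sink ca 2≤ca xa 3≤xa))
        (inj₂ (_ , _ , ba)) → m<n⇒n≢0 2≤ab (two-way-empty ab ba)
      (no 5≰abx) → case heavy⇒cyclic {c} {a} {x} (heavy-cax 5≰abx) of λ where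
        (inj₁ (_ , ax , _)) → m<n⇒n≢0 1≤bx (no-common-source ab 2≤ab ax 3≤ax)
        (inj₂ (_ , _ , ac)) → m<n⇒n≢0 2≤ca (two-way-empty ca ac)
    where
    2≤ab = heavy⇒2≤ (heavy-rotate heavy)
    2≤ca = heavy⇒2≤ heavy
    4≤bx+cx : 4 ≤ mult b x + mult c x
    4≤bx+cx = m+n≤o+p⇒o≤m⇒n≤p 3 (subst (7 ≤_) (+-assoc (mult a x) (mult b x) (mult c x)) dense)
                (mult≤3 a x)
    1≤bx : 1 ≤ mult b x
    1≤bx = m+n≤o+p⇒o≤m⇒n≤p 3 (subst (4 ≤_) (+-comm (mult b x) (mult c x)) 4≤bx+cx) (mult≤3 c x)
    1≤cx : 1 ≤ mult c x
    1≤cx = m+n≤o+p⇒o≤m⇒n≤p 3 4≤bx+cx (mult≤3 b x)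
    3≤xa : 3 ≤ mult x a
    3≤xa = subst (3 ≤_) (mult-sym a x) 3≤ax
    5≤cax : ¬ 5 ≤ mult a b + mult b x → 5 ≤ mult c a + mult c x
    5≤cax 5≰abx = m+n≤o+p⇒o≤m⇒n≤p 7
      (subst (12 ≤_) (regroup (mult a b) (mult b c) (mult c a) (mult b x) (mult c x)) (+-mono-≤ heavy 4≤bx+cx))
      (+-mono-≤ (≤-pred (≰⇒> 5≰abx)) (mult≤3 b c))
      where
      regroup : ∀ ab bc ca bx cx → ab + bc + ca + (bx + cx) ≡ ab + bx + bc + (ca + cx)
      regroup = solve-∀
    heavy-cax : ¬ 5 ≤ mult a b + mult b x → Heavy c a x
    heavy-cax 5≰abx = subst (8 ≤_)
      (trans (xy∙z≈xz∙y (mult c a) (mult c x) (mult a x)) (cong (mult c a + mult a x +_) (mult-sym c x)))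
      (+-mono-≤ (5≤cax 5≰abx) 3≤ax)

  cyclic-heavy⇒degree≤6 : ∀ {a b c} → Cyclic a b c → Heavy a b c →
                          ∀ x → mult a x + mult b x + mult c x ≤ 6
  cyclic-heavy⇒degree≤6 {a} {b} {c} cyclic heavy x with 7 ≤? mult a x + mult b x + mult c x
  ... | no 7≰ = ≤-pred (≰⇒> 7≰)
  ... | yes 7≤ with pigeonhole (mult a x) (mult b x) (mult c x) 7≤
  ...   | inj₁ 3≤ax        = ⊥-elim (cyclic-heavy-full⇒degree≱7 cyclic heavy 3≤ax 7≤)
  ...   | inj₂ (inj₁ 3≤bx) = ⊥-elim (cyclic-heavy-full⇒degree≱7 (cyclic-rotate cyclic)
                               (heavy-rotate heavy) 3≤bx
                               (subst (7 ≤_) (xy∙z≈yz∙x (mult a x) (mult b x) (mult c x)) 7≤))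
  ...   | inj₂ (inj₂ 3≤cx) = ⊥-elim (cyclic-heavy-full⇒degree≱7 (cyclic-rotate (cyclic-rotate cyclic))
                               (heavy-rotate (heavy-rotate heavy)) 3≤cx
                               (subst (7 ≤_) (xy∙z≈zx∙y (mult a x) (mult b x) (mult c x)) 7≤))

  heavy⇒degree≤6 : ∀ {a b c} → Heavy a b c → ∀ x → mult a x + mult b x + mult c x ≤ 6
  heavy⇒degree≤6 {a} {b} {c} heavy x with heavy⇒cyclic heavy
  ... | inj₁ cyclic = cyclic-heavy⇒degree≤6 cyclic heavy x
  ... | inj₂ cyclic = subst (_≤ 6) (xy∙z≈xz∙y (mult a x) (mult c x) (mult b x))
                        (cyclic-heavy⇒degree≤6 cyclic (heavy-reflect heavy) x)

  degree : List V → V → ℕ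
  degree B y = sum (map (λ z → mult z y) B)

  heavy-of-full-pair : ∀ {u v w} → 3 ≤ mult u v → 5 ≤ degree (u ∷ v ∷ []) w → Heavy u v w
  heavy-of-full-pair {u} {v} {w} 3≤uv 5≤uvw =
    subst (8 ≤_) (trans (reorder (mult u v) (mult u w) (mult v w)) (cong (mult u v + mult v w +_) (mult-sym u w)))
      (+-mono-≤ 3≤uv 5≤uvw)
    where
    reorder : ∀ a b c → a + (b + (c + 0)) ≡ a + c + b
    reorder = solve-∀

  record Block (L : List V) : Set where
    field
      rest block     : List V
      split          : L ↭ rest ++ block
      block-nonempty : 1 ≤ length block
      block-bound    : pairSum mult block ≤ length block * length block
      rest-bound     : All (λ y → degree block y ≤ 2 * length block) rest

  vertex-block : ∀ {x xs} → All (λ y → mult x y ≤ 2) xs → Block (x ∷ xs)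
  vertex-block {x} {xs} light = record
    { rest           = xs
    ; block          = x ∷ []
    ; split          = ∷↭∷ʳ x xs
    ; block-nonempty = s≤s z≤n
    ; block-bound    = z≤n
    ; rest-bound     = All.map (≤-trans (≤-reflexive (+-identityʳ _))) light
    }

  pair-block : ∀ {L u v L₂} → L ↭ u ∷ v ∷ L₂ → All (λ y → degree (u ∷ v ∷ []) y ≤ 4) L₂ → Block L
  pair-block {u = u} {v} {L₂} split light = record
    { rest           = L₂
    ; block          = u ∷ v ∷ []
    ; split          = ↭-trans split (++-comm (u ∷ v ∷ []) L₂)
    ; block-nonempty = s≤s z≤n
    ; block-bound    = ≤-trans (+-monoˡ-≤ (0 + 0) (+-monoˡ-≤ 0 (mult≤3 v u))) (n≤1+n 3)
    ; rest-bound     = light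
    }

  triangle-block : ∀ {L u v w L₃} → L ↭ u ∷ v ∷ w ∷ L₃ → Heavy u v w → Block L
  triangle-block {u = u} {v} {w} {L₃} split heavy = record
    { rest           = L₃
    ; block          = u ∷ v ∷ w ∷ []
    ; split          = ↭-trans split (++-comm (u ∷ v ∷ w ∷ []) L₃)
    ; block-nonempty = s≤s z≤n
    ; block-bound    = +-mono-≤ (+-mono-≤ (mult≤3 v u) (+-monoˡ-≤ 0 (mult≤3 w u)))
                                (+-monoˡ-≤ (0 + 0) (+-monoˡ-≤ 0 (mult≤3 w v)))
    ; rest-bound     = universal (λ y → subst (_≤ 6) (sym (+-unassoc (mult u y) (mult v y) (mult w y)))
                                              (heavy⇒degree≤6 heavy y)) L₃
    }
    where
    +-unassoc : ∀ a b c → a + (b + (c + 0)) ≡ a + b + c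
    +-unassoc = solve-∀

  find-block : ∀ x xs → Block (x ∷ xs)
  find-block x xs with Any.any? (λ u → Any.any? (λ v → 3 ≤? mult u v) (x ∷ xs)) (x ∷ xs)
  ... | no no-full-pair =
    vertex-block (All.map (≤-pred ∘ ≰⇒>) (¬Any⇒All¬ xs (no-full-pair ∘ here ∘ there)))
  ... | yes full-pair with extract full-pair
  ...   | u , L₁ , full-u , L↭uL₁ with Any-resp-↭ L↭uL₁ full-u
  ...     | here 3≤uu = ⊥-elim (<⇒≱ (s≤s z≤n) (subst (3 ≤_) (mult-self u) 3≤uu))
  ...     | there full-uv with extract full-uv
  ...       | v , L₂ , 3≤uv , L₁↭vL₂ with Any.any? (λ w → 5 ≤? degree (u ∷ v ∷ []) w) L₂
  ...         | no light =
    pair-block (↭-trans L↭uL₁ (prep u L₁↭vL₂)) (All.map (≤-pred ∘ ≰⇒>) (¬Any⇒All¬ L₂ light))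
  ...         | yes heavy-w with extract heavy-w
  ...           | w , L₃ , 5≤uvw , L₂↭wL₃ =
    triangle-block (↭-trans L↭uL₁ (prep u (↭-trans L₁↭vL₂ (prep v L₂↭wL₃)))) (heavy-of-full-pair 3≤uv 5≤uvw)

  pairSum-bound : ∀ L → pairSum mult L ≤ length L * length L
  pairSum-bound L = bound L (<-wellFounded (length L))
    where
    bound : ∀ L → Acc _<_ (length L) → pairSum mult L ≤ length L * length L
    bound []       _         = z≤n
    bound (x ∷ xs) (acc rec) = begin
      pairSum mult (x ∷ xs)                            ≡⟨ pairSum-↭ mult-sym split ⟩
      pairSum mult (rest ++ block)                     ≤⟨ pairSum-++-≤ mult rest block
                                                            (bound rest (rec shorter)) rest-bound block-bound ⟩
      length (rest ++ block) * length (rest ++ block)  ≡⟨ cong (λ k → k * k) (↭-length split) ⟨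
      length (x ∷ xs) * length (x ∷ xs)                ∎
      where
      open ≤-Reasoning
      open Block (find-block x xs)
      shorter : length rest < length (x ∷ xs)
      shorter = begin-strict
        length rest                   <⟨ m<m+n (length rest) block-nonempty ⟩
        length rest + length block    ≡⟨ length-++ rest ⟨
        length (rest ++ block)        ≡⟨ ↭-length split ⟨
        length (x ∷ xs)               ∎

-- Coloured oriented graphs

rainbow-of-source : ∀ {c n} {G : Fin c → DiGraph n} → (∀ i → Loopless (G i)) →
                    ∀ {s t r i j k} → i ≢ j → i ≢ k → j ≢ k →
                    T (G i s t) → T (G j s r) → T (G k t r) ⊎ T (G k r t) → RainbowTransitiveTriangle G
rainbow-of-source {G = G} loopless {s} {t} {r} {i} {j} {k} i≢j i≢k j≢k st sr = [ via-tr , via-rt ]′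
  where
  distinct : ∀ {l u v} → T (G l u v) → u ≢ v
  distinct {l} {u} uv refl = subst T (loopless l u) uv
  via-tr : T (G k t r) → RainbowTransitiveTriangle G
  via-tr tr = s , t , r , i , k , j , (distinct st , distinct tr , distinct sr) ,
              (i≢k , ≢-sym j≢k , i≢j) , (st , tr , sr)
  via-rt : T (G k r t) → RainbowTransitiveTriangle G
  via-rt rt = s , r , t , j , k , i , (distinct sr , distinct rt , distinct st) ,
              (j≢k , ≢-sym i≢k , ≢-sym i≢j) , (sr , rt , st)

rainbow? : ∀ {c n} (G : Fin c → DiGraph n) → Dec (RainbowTransitiveTriangle G)
rainbow? G = any? λ u → any? λ v → any? λ w → any? λ a → any? λ b → any? λ d →
  (¬? (u ≟ᶠ v) ×-dec ¬? (v ≟ᶠ w) ×-dec ¬? (u ≟ᶠ w)) ×-dec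
  (¬? (a ≟ᶠ b) ×-dec ¬? (b ≟ᶠ d) ×-dec ¬? (a ≟ᶠ d)) ×-dec
  (T? (G a u v) ×-dec T? (G b v w) ×-dec T? (G d u w))

-- p and q say whether there are edges x → y and y → x; an oriented graph never has both.
dir : Bool → Bool → Dir
dir true  _     = fwd
dir false true  = bwd
dir false false = none

dir-swap : ∀ {p q} → ¬ (T p × T q) → dir q p ≡ opposite (dir p q)
dir-swap {true}  {true}  ¬pq = ⊥-elim (¬pq _)
dir-swap {true}  {false} _   = refl
dir-swap {false} {true}  _   = refl
dir-swap {false} {false} _   = refl

present-dir : ∀ {p q} → ¬ (T p × T q) → present (dir p q) ≡ ind p + ind q
present-dir {true}  {true}  ¬pq = ⊥-elim (¬pq _)
present-dir {true}  {false} _   = refl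
present-dir {false} {true}  _   = refl
present-dir {false} {false} _   = refl

dir-fwd : ∀ {p q} → T (isFwd (dir p q)) → T p
dir-fwd {true}          _ = _
dir-fwd {false} {true}  ()
dir-fwd {false} {false} ()

dir-bwd : ∀ {p q} → T (isBwd (dir p q)) → T q
dir-bwd {true}          ()
dir-bwd {false} {true}  _ = _
dir-bwd {false} {false} ()

dir-present : ∀ {p q} → T (isPresent (dir p q)) → T p ⊎ T q
dir-present {true}          _ = inj₁ _
dir-present {false} {true}  _ = inj₂ _
dir-present {false} {false} ()

T-source : ∀ {out in′ opp} → T (source out in′ opp) → T (isFwd out) × T (isBwd in′) × T (isPresent opp)
T-source {out} s with Equivalence.to (T-∧ {isFwd out}) s
... | fwd-out , rest = fwd-out , Equivalence.to T-∧ rest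

module ThreeColours {n : ℕ} (H : Fin 3 → DiGraph n) (oriented : ∀ i → Oriented (H i)) where

  loopless : ∀ i → Loopless (H i)
  loopless = proj₁ ∘ oriented

  asymmetric : ∀ i x y → ¬ (T (H i x y) × T (H i y x))
  asymmetric = proj₂ ∘ oriented

  link : Fin n → Fin n → Link
  link x y = dir (H 0F x y) (H 0F y x) , dir (H 1F x y) (H 1F y x) , dir (H 2F x y) (H 2F y x)

  link-at : ∀ i x y → link x y at i ≡ dir (H i x y) (H i y x)
  link-at 0F x y = refl
  link-at 1F x y = refl
  link-at 2F x y = refl

  link-reverse : ∀ x y → link y x ≡ reverse (link x y)
  link-reverse x y = cong₂ _,_ (dir-swap (asymmetric 0F x y))
                       (cong₂ _,_ (dir-swap (asymmetric 1F x y)) (dir-swap (asymmetric 2F x y)))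

  -- Colours: i on s → t, j on s → r, k between t and r.
  rainbow-at-source : ∀ {s t r i j k} → i ≢ j → i ≢ k → j ≢ k →
                      T (source (dir (H i s t) (H i t s)) (dir (H j r s) (H j s r)) (dir (H k t r) (H k r t))) →
                      RainbowTransitiveTriangle H
  rainbow-at-source i≢j i≢k j≢k src with T-source src
  ... | out , in′ , opp = rainbow-of-source loopless i≢j i≢k j≢k (dir-fwd out) (dir-bwd in′) (dir-present opp)

  link-consistent : ¬ RainbowTransitiveTriangle H → ∀ a b c → Consistent (link a b) (link b c) (link c a)
  link-consistent ¬rainbow a b c i j k i≢j j≢k i≢k transitive-abc
    rewrite link-at i a b | link-at j b c | link-at k c a
    with Equivalence.to T-∨ transitive-abc
  ... | inj₁ at-a = ¬rainbow (rainbow-at-source i≢k i≢j (≢-sym j≢k) at-a)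
  ... | inj₂ at-b-or-c with Equivalence.to T-∨ at-b-or-c
  ...   | inj₁ at-b = ¬rainbow (rainbow-at-source (≢-sym i≢j) j≢k i≢k at-b)
  ...   | inj₂ at-c = ¬rainbow (rainbow-at-source (≢-sym j≢k) (≢-sym i≢k) (≢-sym i≢j) at-c)

  colours : Fin n → Fin n → ℕ
  colours x y = sumFin (λ i → ind (H i x y))

  colours-self : ∀ x → colours x x ≡ 0
  colours-self x rewrite loopless 0F x | loopless 1F x | loopless 2F x = refl

  weight-link : ∀ x y → weight (link x y) ≡ colours x y + colours y x
  weight-link x y = trans
    (cong₂ _+_ (cong₂ _+_ (present-dir (asymmetric 0F x y)) (present-dir (asymmetric 1F x y)))
               (present-dir (asymmetric 2F x y)))
    (shuffle (ind (H 0F x y)) (ind (H 0F y x)) (ind (H 1F x y)) (ind (H 1F y x)) (ind (H 2F x y)) (ind (H 2F y x)))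
    where
    shuffle : ∀ a a′ b b′ c c′ →
              a + a′ + (b + b′) + (c + c′) ≡ a + (b + (c + 0)) + (a′ + (b′ + (c′ + 0)))
    shuffle = solve-∀

  edges≡pairSum : sumFin (λ i → e (H i)) ≡ pairSum (λ x y → weight (link x y)) (allFin n)
  edges≡pairSum = begin
    sumFin (λ i → sumFin (λ u → sumFin (λ v → ind (H i u v))))
      ≡⟨ sumFin-comm (λ i u → sumFin (λ v → ind (H i u v))) ⟩
    sumFin (λ u → sumFin (λ i → sumFin (λ v → ind (H i u v))))
      ≡⟨ cong sum (map-cong (λ u → sumFin-comm (λ i v → ind (H i u v))) (allFin n)) ⟩
    sumFin (λ u → sumFin (λ v → colours u v))
      ≡⟨ double-sum≡pairSum colours colours-self weight-link (allFin n) ⟩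
    pairSum (λ x y → weight (link x y)) (allFin n) ∎
    where open ≡-Reasoning

  rainbow-free-sparse : ¬ RainbowTransitiveTriangle H → sumFin (λ i → e (H i)) ≤ n * n
  rainbow-free-sparse ¬rainbow = begin
    sumFin (λ i → e (H i))                 ≡⟨ edges≡pairSum ⟩
    pairSum mult (allFin n)                ≤⟨ pairSum-bound (allFin n) ⟩
    length (allFin n) * length (allFin n)  ≡⟨ cong (λ k → k * k) (length-tabulate {n = n} id) ⟩
    n * n                                  ∎
    where
    open ≤-Reasoning
    open LinkStructure link link-reverse (link-consistent ¬rainbow)

-- Any number of colours

rainbow-of-dense₃ : ∀ {n} (H : Fin 3 → DiGraph n) → (∀ i → Oriented (H i)) →
                    n * n < sumFin (λ i → e (H i)) → RainbowTransitiveTriangle H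
rainbow-of-dense₃ H oriented dense with rainbow? H
... | yes rainbow  = rainbow
... | no ¬rainbow = ⊥-elim (<⇒≱ dense (ThreeColours.rainbow-free-sparse H oriented ¬rainbow))

rainbow-of-dense : ∀ k {n} (G : Fin (3 + k) → DiGraph n) → (∀ i → Oriented (G i)) →
                   (3 + k) * (n * n) < 3 * sumFin (λ i → e (G i)) → RainbowTransitiveTriangle G
rainbow-of-dense zero        G oriented dense = rainbow-of-dense₃ G oriented (*-cancelˡ-< 3 _ _ dense)
rainbow-of-dense (suc k) {n} G oriented dense =
  rainbow-recolour G (punchIn-injective i _ _)
    (rainbow-of-dense k (G ∘ punchIn i) (oriented ∘ punchIn i) dense′)
  where
  weights : Fin (4 + k) → ℕ
  weights j = e (G j)
  i : Fin (4 + k)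
  i = proj₁ (minimum weights)
  dense′ : (3 + k) * (n * n) < 3 * sumFin (weights ∘ punchIn i)
  dense′ = lightest-removable (3 + k) {n * n} {weights i} {sumFin (weights ∘ punchIn i)}
    (subst ((4 + k) * weights i ≤_) (sumFin-remove weights i) (*≤sumFin weights (proj₂ (minimum weights))))
    (subst (λ t → (4 + k) * (n * n) < 3 * t) (sumFin-remove weights i) dense)

theorem10 : (c n : ℕ) → c ≥ 3 → (G : Fin c → DiGraph n) →
    (∀ i → Oriented (G i)) →
    3 * sumFin (λ i → e (G i)) > c * (n * n) →
    RainbowTransitiveTriangle G
theorem10 _ _ (s≤s (s≤s (s≤s {n = k} z≤n))) = rainbow-of-dense k
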